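{- Let $F$ be a one-dimensional cellular automaton with finite state set $A$, and let $x\in\mathbb{Z}$ and $y,l,r\in\mathbb{N}$. If $F$ has the property $P(x,y,l,r)$, then the image $F^y(A^{\mathbb{Z}})$ contains all words of length $\max(l,r)+1$ (i.e. every word $w\in A^{\max(l,r)+1}$ appears as a factor of some configuration in $F^y(A^{\mathbb{Z}})$).
   Context: A one-dimensional cellular automaton (CA) with finite state set $A$ is identified with its global map $F:A^{\mathbb{Z}}\to A^{\mathbb{Z}}$ (continuous and commuting with the shift). For a configuration $c\in A^{\mathbb{Z}}$ and $q\in A$, let $\phi_c(q)$ be the configuration equal to $q$ at position $0$ and to $c(z)$ at every position $z\neq 0$. For $x\in\mathbb{Z}$, $y\in\mathbb{N}$, let $F^y_{x,c}:A\to A$ be the map $q\mapsto (F^y(\phi_c(q)))_x$. For $x\in\mathbb{Z}$ and $y,l,r\in\mathbb{N}$, $F$ has property $P(x,y,l,r)$ if (1) $F^y_{x,c}$ is a bijection for every configuration $c$, and (2) $F^y_{z,c}$ is a constant function for every configuration $c$ and every integer $z\in[x-l,x+r]\setminus\{x\}$. -}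

module Defs where

open import Data.Nat using (ℕ; zero; suc; _⊔_)
open import Data.Fin using (Fin; toℕ)
open import Data.Integer as ℤ using (ℤ; +_; _+_; _-_; _≤_; ∣_∣)
open import Data.Product using (Σ; ∃; _×_; _,_)
open import Relation.Nullary using (¬_; yes; no)
open import Relation.Binary.PropositionalEquality using (_≡_)
open import Function.Definitions using (Bijective)

Config : ℕ → Set
Config k = ℤ → Fin k

σ : ∀ {k} → Config k → Config k
σ c z = c (z + + 1)

-- Continuity w.r.t. the product (Cantor) topology, A discrete:
-- each output cell depends (near c) only on a finite window of c.
Continuous : ∀ {k} → (Config k → Config k) → Set
Continuous {k} F = ∀ (c : Config k) (x : ℤ) → ∃ λ (n : ℕ) →
  ∀ (c′ : Config k) → (∀ z → ∣ z ∣ Data.Nat.≤ n → c z ≡ c′ z) → F c x ≡ F c′ x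

ShiftCommuting : ∀ {k} → (Config k → Config k) → Set
ShiftCommuting {k} F = ∀ (c : Config k) (z : ℤ) → F (σ c) z ≡ σ (F c) z

IsCA : ∀ {k} → (Config k → Config k) → Set
IsCA F = Continuous F × ShiftCommuting F

iter : ∀ {k} → (Config k → Config k) → ℕ → Config k → Config k
iter F zero c = c
iter F (suc n) c = F (iter F n c)

φ : ∀ {k} → Config k → Fin k → Config k
φ c q z with z ℤ.≟ + 0
... | yes _ = q
... | no _ = c z

local : ∀ {k} → (Config k → Config k) → ℕ → ℤ → Config k → Fin k → Fin k
local F y x c q = iter F y (φ c q) x

P : ∀ {k} → (Config k → Config k) → ℤ → ℕ → ℕ → ℕ → Set
P {k} F x y l r =
  (∀ (c : Config k) → Bijective _≡_ _≡_ (local F y x c)) ×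
  (∀ (c : Config k) (z : ℤ) → x - + l ≤ z → z ≤ x + + r → ¬ (z ≡ x) →
     ∀ (q q′ : Fin k) → local F y z c q ≡ local F y z c q′)

OccursInImage : ∀ {k} → (Config k → Config k) → ℕ → (m : ℕ) → (Fin m → Fin k) → Set
OccursInImage {k} F y m w = ∃ λ (c : Config k) → ∃ λ (i : ℤ) →
  ∀ (j : Fin m) → iter F y c (i + + toℕ j) ≡ w j

-- Changing the single cell n of a configuration lets F^y take any prescribed
-- value at x + n (bijectivity) and, by shift invariance, leaves F^y unchanged at
-- every x + j with j ∈ [n - l, n + r], j ≠ n. So a word of length max(l,r) + 1
-- can be written at x, …, x + max(l,r) one letter at a time without destroying
-- the letters already written: left to right when r ≤ l (all earlier letters
-- lie within distance l to the left), right to left when l ≤ r.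

module Submission where

open import Defs
open import Data.Nat as ℕ using (ℕ; zero; suc; _⊔_; _≤_; _<_; _∸_; s≤s)
open import Data.Nat.Properties
  using (≤-refl; ≤-trans; ≤-total; ≤-pred; <⇒≤; <⇒≢; m≤m+n; m≤n+m; m≤n⇒m≤1+n;
         m≤n⇒m<n∨m≡n; m∸n≤m; ∸-monoʳ-≤; ∸-cancelˡ-≡; m∸[m∸n]≡n; ⊔-lub)
open import Data.Nat.DivMod using (_mod_; m<n⇒m%n≡m)
open import Data.Fin using (Fin; toℕ)
open import Data.Fin.Properties using (toℕ-injective; toℕ-fromℕ<; toℕ<n)
open import Data.Integer as ℤ using (ℤ; +_; _+_; _-_; -_; +≤+)
open import Data.Integer.Properties
  using (+-identityʳ; +-assoc; +-injective; +-monoˡ-≤; +-monoʳ-≤; neg-mono-≤;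
         +-0-abelianGroup; module ≤-Reasoning)
open import Data.Integer.Tactic.RingSolver using (solve-∀)
open import Algebra.Properties.AbelianGroup +-0-abelianGroup using (∙-cancelˡ; ∙-cancelʳ)
open import Data.Product using (∃; _×_; _,_; proj₁; proj₂)
open import Data.Sum using (inj₁; inj₂)
open import Data.Empty using (⊥-elim)
open import Function using (id)
open import Relation.Nullary using (yes; no)
open import Relation.Binary.PropositionalEquality
  using (_≡_; _≢_; _≗_; refl; sym; trans; cong; subst; module ≡-Reasoning)

update : ∀ {k} → Config k → ℕ → Fin k → Config k
update c n q z with z ℤ.≟ + n
... | yes _ = q
... | no _  = c z

update-self : ∀ {k} (c : Config k) n → update c n (c (+ n)) ≗ c
update-self c n z with z ℤ.≟ + n
... | yes z≡n = cong c (sym z≡n)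
... | no _    = refl

shift : ∀ {k} → ℕ → Config k → Config k
shift n c z = c (z + + n)

φ-shift : ∀ {k} (c : Config k) n q → φ (shift n c) q ≗ shift n (update c n q)
φ-shift c n q z with z ℤ.≟ + 0 | z + + n ℤ.≟ + n
... | yes _   | yes _     = refl
... | no _    | no _      = refl
... | yes z≡0 | no z+n≢n  = ⊥-elim (z+n≢n (cong (_+ + n) z≡0))
... | no z≢0  | yes z+n≡n = ⊥-elim (z≢0 (∙-cancelʳ (+ n) z (+ 0) z+n≡n))

module _ {k : ℕ} (F : Config k → Config k) (isCA : IsCA F) where

  -- Lacking function extensionality, continuity is what makes F respect ≗.
  F-cong : ∀ {c d} → c ≗ d → F c ≗ F d
  F-cong {c} {d} c≗d z = proj₂ (proj₁ isCA c z) d (λ z′ _ → c≗d z′)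

  iter-cong : ∀ y {c d} → c ≗ d → iter F y c ≗ iter F y d
  iter-cong zero    c≗d = c≗d
  iter-cong (suc y) c≗d = F-cong (iter-cong y c≗d)

  F-shift : ∀ n c → F (shift n c) ≗ shift n (F c)
  F-shift zero c z =
    trans (F-cong (λ z′ → cong c (+-identityʳ z′)) z) (cong (F c) (sym (+-identityʳ z)))
  F-shift (suc n) c z = begin
    F (shift (suc n) c) z     ≡⟨ F-cong (λ z′ → cong c (sym (+-assoc z′ (+ 1) (+ n)))) z ⟩
    F (σ (shift n c)) z       ≡⟨ proj₂ isCA (shift n c) z ⟩
    F (shift n c) (z + + 1)   ≡⟨ F-shift n c (z + + 1) ⟩
    F c (z + + 1 + + n)       ≡⟨ cong (F c) (+-assoc z (+ 1) (+ n)) ⟩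
    F c (z + + suc n)         ∎
    where open ≡-Reasoning

  iter-shift : ∀ y n c → iter F y (shift n c) ≗ shift n (iter F y c)
  iter-shift zero    n c z = refl
  iter-shift (suc y) n c z = trans (F-cong (iter-shift y n c) z) (F-shift n (iter F y c) z)

  local-shift : ∀ y z n c q → local F y z (shift n c) q ≡ iter F y (update c n q) (z + + n)
  local-shift y z n c q = trans (iter-cong y (φ-shift c n q) z) (iter-shift y n (update c n q) z)

InWindow : (l r n j : ℕ) → Set
InWindow l r n j = j ≢ n × n ≤ j ℕ.+ l × j ≤ n ℕ.+ r

InWindow-offset : ∀ x {l r n j} → InWindow l r n j →
  let z = x + + j - + n in x - + l ℤ.≤ z × z ℤ.≤ x + + r × z ≢ x
InWindow-offset x {l} {r} {n} {j} (j≢n , n≤j+l , j≤n+r) = lower , upper , z≢x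
  where
  open ≤-Reasoning
  lower : x - + l ℤ.≤ x + + j - + n
  lower = begin
    x - + l                 ≡⟨ sub-via (x) (+ j) (+ l) ⟩
    x + + j - + (j ℕ.+ l)   ≤⟨ +-monoʳ-≤ (x + + j) (neg-mono-≤ (+≤+ n≤j+l)) ⟩
    x + + j - + n           ∎
    where
    sub-via : ∀ a b c → a - c ≡ a + b - (b + c)
    sub-via = solve-∀
  upper : x + + j - + n ℤ.≤ x + + r
  upper = begin
    x + + j - + n           ≤⟨ +-monoˡ-≤ (- + n) (+-monoʳ-≤ x (+≤+ j≤n+r)) ⟩
    x + + (n ℕ.+ r) - + n   ≡⟨ add-sub x (+ n) (+ r) ⟩
    x + + r                 ∎
    where
    add-sub : ∀ a b c → a + (b + c) - b ≡ a + c
    add-sub = solve-∀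
  z≢x : x + + j - + n ≢ x
  z≢x z≡x = j≢n (+-injective (∙-cancelˡ x (+ j) (+ n) (begin-equality
    x + + j                 ≡⟨ sub-add (x + + j) (+ n) ⟨
    x + + j - + n + + n     ≡⟨ cong (_+ + n) z≡x ⟩
    x + + n                 ∎)))
    where
    sub-add : ∀ a b → a - b + b ≡ a
    sub-add = solve-∀

ascending-inWindow : ∀ {l r L i m} → L ≤ l → i < m → m ≤ L → InWindow l r m i
ascending-inWindow {l} {r} L≤l i<m m≤L =
  <⇒≢ i<m , ≤-trans (≤-trans m≤L L≤l) (m≤n+m l _) , ≤-trans (<⇒≤ i<m) (m≤m+n _ r)

descending-inWindow : ∀ {l r L i m} → L ≤ r → i < m → m ≤ L → InWindow l r (L ∸ m) (L ∸ i)
descending-inWindow {l} {r} {L} {i} L≤r i<m m≤L =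
  (λ eq → <⇒≢ i<m (∸-cancelˡ-≡ (≤-trans (<⇒≤ i<m) m≤L) m≤L eq)) ,
  ≤-trans (∸-monoʳ-≤ L (<⇒≤ i<m)) (m≤m+n _ l) ,
  ≤-trans (m∸n≤m L i) (≤-trans L≤r (m≤n+m r _))

toℕ-mod : ∀ {n} (j : Fin (suc n)) → toℕ j mod suc n ≡ j
toℕ-mod j = toℕ-injective (trans (toℕ-fromℕ< _) (m<n⇒m%n≡m (toℕ<n j)))

module Filling {k : ℕ} (F : Config k → Config k) (isCA : IsCA F)
                (x : ℤ) (y l r : ℕ) (p : P F x y l r) where

  update-hits : ∀ c n t → ∃ λ q → iter F y (update c n q) (x + + n) ≡ t
  update-hits c n t =
    let q , hit = proj₂ (proj₁ p (shift n c)) t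
    in q , trans (sym (local-shift F isCA y x n c q)) (hit refl)

  update-invisible : ∀ c n q {z} → x - + l ℤ.≤ z → z ℤ.≤ x + + r → z ≢ x →
    iter F y (update c n q) (z + + n) ≡ iter F y c (z + + n)
  update-invisible c n q {z} lo hi z≢x = begin
    iter F y (update c n q) (z + + n)          ≡⟨ local-shift F isCA y z n c q ⟨
    local F y z (shift n c) q                  ≡⟨ proj₂ p (shift n c) z lo hi z≢x q (c (+ n)) ⟩
    local F y z (shift n c) (c (+ n))          ≡⟨ local-shift F isCA y z n c (c (+ n)) ⟩
    iter F y (update c n (c (+ n))) (z + + n)  ≡⟨ iter-cong F isCA y (update-self c n) (z + + n) ⟩
    iter F y c (z + + n)                       ∎
    where open ≡-Reasoning

  edit : ∀ c n t → ∃ λ c′ → iter F y c′ (x + + n) ≡ t ×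
    (∀ j → InWindow l r n j → iter F y c′ (x + + j) ≡ iter F y c (x + + j))
  edit c n t = let q , hit = update-hits c n t in update c n q , hit , keep q
    where
    keep : ∀ q j → InWindow l r n j → iter F y (update c n q) (x + + j) ≡ iter F y c (x + + j)
    keep q j inW =
      let lo , hi , z≢x = InWindow-offset x inW
      in subst (λ u → iter F y (update c n q) u ≡ iter F y c u) (sub-add (x + + j) (+ n))
               (update-invisible c n q lo hi z≢x)
      where
      sub-add : ∀ a b → a - b + b ≡ a
      sub-add = solve-∀

  fillInOrder : (τ : ℕ → Fin k) (π : ℕ → ℕ) (L : ℕ) →
    (∀ {i m} → i < m → m ≤ L → InWindow l r (π m) (π i)) →
    ∀ m → m ≤ suc L → ∃ λ c → ∀ i → i < m → iter F y c (x + + π i) ≡ τ (π i)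
  fillInOrder τ π L inWindow zero _ = (λ _ → τ 0) , λ _ ()
  fillInOrder τ π L inWindow (suc m) (s≤s m≤L)
    with fillInOrder τ π L inWindow m (m≤n⇒m≤1+n m≤L)
  ... | c , filled with edit c (π m) (τ (π m))
  ... | c′ , hit , keep = c′ , filled′
    where
    filled′ : ∀ i → i < suc m → iter F y c′ (x + + π i) ≡ τ (π i)
    filled′ i (s≤s i≤m) with m≤n⇒m<n∨m≡n i≤m
    ... | inj₂ refl = hit
    ... | inj₁ i<m  = trans (keep (π i) (inWindow i<m m≤L)) (filled i i<m)

  occursInImage-byOrder : ∀ L (π : ℕ → ℕ) →
    (∀ {i m} → i < m → m ≤ L → InWindow l r (π m) (π i)) →
    (∀ {j} → j ≤ L → ∃ λ i → i ≤ L × π i ≡ j) →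
    ∀ w → OccursInImage F y (suc L) w
  occursInImage-byOrder L π inWindow onto w
    with fillInOrder (λ j → w (j mod suc L)) π L inWindow (suc L) ≤-refl
  ... | c , filled = c , x , written
    where
    -- mod only extends w to all of ℕ; it is the identity on the cells written.
    written : ∀ j → iter F y c (x + + toℕ j) ≡ w j
    written j =
      let i , i≤L , πi≡j = onto (≤-pred (toℕ<n j))
      in trans (subst (λ u → iter F y c (x + + u) ≡ w (u mod suc L)) πi≡j (filled i (s≤s i≤L)))
               (cong w (toℕ-mod j))

lemma1 : (k : ℕ) (F : Config k → Config k) → IsCA F →
    (x : ℤ) (y l r : ℕ) → P F x y l r →
    ∀ (w : Fin (suc (l ⊔ r)) → Fin k) → OccursInImage F y (suc (l ⊔ r)) w
lemma1 k F isCA x y l r p with ≤-total r l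
... | inj₁ r≤l = occursInImage-byOrder (l ⊔ r) id
      (ascending-inWindow (⊔-lub ≤-refl r≤l)) (λ {j} j≤L → j , j≤L , refl)
  where open Filling F isCA x y l r p
... | inj₂ l≤r = occursInImage-byOrder (l ⊔ r) (l ⊔ r ∸_)
      (descending-inWindow (⊔-lub l≤r ≤-refl)) (λ {j} j≤L → l ⊔ r ∸ j , m∸n≤m _ j , m∸[m∸n]≡n j≤L)
  where open Filling F isCA x y l r p
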